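{- Let $G$ be a finite bipartite graph with parts $V$ and $U$, and let $f:V\cup U\to\{1,\dots,k\}$ be a perfect coloring of $G$. Then the restriction $f|_V$ is a perfect coloring of the multigraph $\mathcal{M}_{12}(G)$.
   Context: $\mathcal{M}_{12}(G)$ is the multigraph on vertex set $V$ with adjacency matrix $YY^{*}$, where $Y$ is the $V\times U$ biadjacency matrix of $G$: two distinct $v,v'\in V$ are joined by as many edges as they have common neighbours in $U$, and each $v\in V$ carries $\deg_G(v)$ loops. For a multigraph with adjacency matrix $M$, a coloring $f$ is perfect if there is a matrix $S=(s_{ij})$ such that for all colors $i,j$ and every vertex $x$ of color $i$, $\sum_{y:\,f(y)=j}M_{xy}=s_{ij}$. For a simple graph this means every vertex of color $i$ has exactly $s_{ij}$ neighbours of color $j$. -}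

module Defs where

open import Data.Nat using (ℕ; zero; suc; _+_; _*_)
open import Data.Bool using (Bool; true; false; if_then_else_)
open import Data.Fin using (Fin; zero; suc; _≟_)
open import Data.Sum using (_⊎_; inj₁; inj₂)
open import Data.Product using (∃)
open import Relation.Nullary using (does)
open import Relation.Binary.PropositionalEquality using (_≡_)

∑ : (N : ℕ) → (Fin N → ℕ) → ℕ
∑ zero    g = 0
∑ (suc N) g = g zero + ∑ N (λ i → g (suc i))

∑⊎ : (n m : ℕ) → (Fin n ⊎ Fin m → ℕ) → ℕ
∑⊎ n m g = ∑ n (λ v → g (inj₁ v)) + ∑ m (λ u → g (inj₂ u))

⟦_⟧ : Bool → ℕ
⟦ b ⟧ = if b then 1 else 0

-- A (multi)graph on a finite vertex type X is given by its adjacency matrix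
-- M : X → X → ℕ, together with a summation operator over X.
IsPerfectColoring : {X : Set} → ((X → ℕ) → ℕ) → (X → X → ℕ) →
                    (k : ℕ) → (X → Fin k) → Set
IsPerfectColoring {X} sumX M k f =
  ∃ λ (S : Fin k → Fin k → ℕ) →
    ∀ (x : X) (j : Fin k) →
      sumX (λ y → M x y * ⟦ does (f y ≟ j) ⟧) ≡ S (f x) j

-- A finite bipartite (simple) graph G with parts V = Fin n and U = Fin m is
-- given by its V × U biadjacency matrix Y : Fin n → Fin m → Bool.
bipAdj : {n m : ℕ} → (Fin n → Fin m → Bool) →
         Fin n ⊎ Fin m → Fin n ⊎ Fin m → ℕ
bipAdj Y (inj₁ v) (inj₁ v') = 0
bipAdj Y (inj₁ v) (inj₂ u)  = ⟦ Y v u ⟧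
bipAdj Y (inj₂ u) (inj₁ v)  = ⟦ Y v u ⟧
bipAdj Y (inj₂ u) (inj₂ u') = 0

-- The multigraph M₁₂(G) on V with adjacency matrix Y Yᵀ:
-- entry (v, v') = number of common neighbours in U (for v = v' this is deg v,
-- i.e. the number of loops at v).
M₁₂ : {n m : ℕ} → (Fin n → Fin m → Bool) → Fin n → Fin n → ℕ
M₁₂ {n} {m} Y v v' = ∑ m (λ u → ⟦ Y v u ⟧ * ⟦ Y v' u ⟧)

{-# OPTIONS --safe #-}
module Submission where

-- Perfectness of f on G says that the biadjacency matrix Y is equitable from
-- the colouring of V to that of U, and its transpose from U to V, both with
-- quotient matrix S: every row of colour i has total weight S i j on colour
-- class j. An equitable matrix A sends any function h ∘ g of the colour to
-- (S h) ∘ f, so equitability is closed under matrix products, the quotients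
-- multiplying. Hence Y Yᵀ, the adjacency matrix of M₁₂(G), is equitable from
-- the colouring of V to itself with quotient S², i.e. f restricted to V is
-- perfect.

open import Defs
open import Data.Nat using (ℕ; zero; suc; _+_; _*_)
open import Data.Nat.Properties using (+-*-semiring; *-assoc; +-identityʳ)
open import Data.Bool using (Bool)
open import Data.Fin using (Fin; zero; suc; _≟_)
open import Data.Sum using (_⊎_; inj₁; inj₂)
open import Data.Product using (_,_)
open import Function using (_∘_; flip)
open import Relation.Nullary using (does)
open import Relation.Binary.PropositionalEquality
open import Algebra.Properties.Semiring.Sum +-*-semiring
  using (sum; sum-cong-≗; sum-replicate-zero; ∑-comm; *-distribˡ-sum; *-distribʳ-sum)
open ≡-Reasoning

∑≗sum : ∀ N (g : Fin N → ℕ) → ∑ N g ≡ sum g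
∑≗sum zero    g = refl
∑≗sum (suc N) g = cong (g zero +_) (∑≗sum N (g ∘ suc))

∑-cong : ∀ N {g h : Fin N → ℕ} → g ≗ h → ∑ N g ≡ ∑ N h
∑-cong N {g} {h} g≗h = trans (∑≗sum N g) (trans (sum-cong-≗ g≗h) (sym (∑≗sum N h)))

∑-zero : ∀ N → ∑ N (λ _ → 0) ≡ 0
∑-zero N = trans (∑≗sum N _) (sum-replicate-zero N)

∑-*ˡ : ∀ N c (g : Fin N → ℕ) → c * ∑ N g ≡ ∑ N (λ i → c * g i)
∑-*ˡ N c g = begin
  c * ∑ N g             ≡⟨ cong (c *_) (∑≗sum N g) ⟩
  c * sum g             ≡⟨ *-distribˡ-sum c g ⟩
  sum (λ i → c * g i)   ≡⟨ ∑≗sum N _ ⟨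
  ∑ N (λ i → c * g i)   ∎

∑-*ʳ : ∀ N c (g : Fin N → ℕ) → ∑ N g * c ≡ ∑ N (λ i → g i * c)
∑-*ʳ N c g = begin
  ∑ N g * c             ≡⟨ cong (_* c) (∑≗sum N g) ⟩
  sum g * c             ≡⟨ *-distribʳ-sum c g ⟩
  sum (λ i → g i * c)   ≡⟨ ∑≗sum N _ ⟨
  ∑ N (λ i → g i * c)   ∎

∑-swap : ∀ a b (h : Fin a → Fin b → ℕ) →
         ∑ a (λ i → ∑ b (h i)) ≡ ∑ b (λ j → ∑ a (λ i → h i j))
∑-swap a b h = begin
  ∑ a (λ i → ∑ b (h i))             ≡⟨ ∑≗sum² a b h ⟩
  sum (λ i → sum (h i))             ≡⟨ ∑-comm h ⟩
  sum (λ j → sum (λ i → h i j))     ≡⟨ ∑≗sum² b a (flip h) ⟨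
  ∑ b (λ j → ∑ a (λ i → h i j))     ∎
  where
  ∑≗sum² : ∀ a b (h : Fin a → Fin b → ℕ) → ∑ a (λ i → ∑ b (h i)) ≡ sum (λ i → sum (h i))
  ∑≗sum² a b h = trans (∑≗sum a _) (sum-cong-≗ (λ i → ∑≗sum b (h i)))

∑⊎-zeroˡ : ∀ n m (g : Fin n ⊎ Fin m → ℕ) → (∀ v → g (inj₁ v) ≡ 0) →
           ∑⊎ n m g ≡ ∑ m (g ∘ inj₂)
∑⊎-zeroˡ n m g g₁≡0 = cong (_+ _) (trans (∑-cong n g₁≡0) (∑-zero n))

∑⊎-zeroʳ : ∀ n m (g : Fin n ⊎ Fin m → ℕ) → (∀ u → g (inj₂ u) ≡ 0) →
           ∑⊎ n m g ≡ ∑ n (g ∘ inj₁)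
∑⊎-zeroʳ n m g g₂≡0 = trans (cong (_ +_) (trans (∑-cong m g₂≡0) (∑-zero m))) (+-identityʳ _)

indicator : ∀ {X : Set} {k} → (X → Fin k) → Fin k → X → ℕ
indicator g j y = ⟦ does (g y ≟ j) ⟧

∑-indicator : ∀ k (d : Fin k) (h : Fin k → ℕ) → ∑ k (λ c → ⟦ does (d ≟ c) ⟧ * h c) ≡ h d
∑-indicator (suc k) zero    h = trans (cong₂ _+_ (+-identityʳ (h zero)) (∑-zero k)) (+-identityʳ _)
∑-indicator (suc k) (suc d) h = ∑-indicator k d (h ∘ suc)

Matrix : ℕ → ℕ → Set
Matrix a b = Fin a → Fin b → ℕ

_▸_ : ∀ {a b} → Matrix a b → (Fin b → ℕ) → Fin a → ℕ
_▸_ {b = b} A v x = ∑ b (λ y → A x y * v y)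

_·_ : ∀ {a b c} → Matrix a b → Matrix b c → Matrix a c
_·_ {b = b} A B x z = ∑ b (λ y → A x y * B y z)

▸-cong : ∀ {a b} (A : Matrix a b) {u v : Fin b → ℕ} → u ≗ v → A ▸ u ≗ A ▸ v
▸-cong {b = b} A u≗v x = ∑-cong b (λ y → cong (A x y *_) (u≗v y))

·-▸-assoc : ∀ {a b c} (A : Matrix a b) (B : Matrix b c) (v : Fin c → ℕ) →
      (A · B) ▸ v ≗ A ▸ (B ▸ v)
·-▸-assoc {b = b} {c} A B v x = begin
  ∑ c (λ z → ∑ b (λ y → A x y * B y z) * v z)
    ≡⟨ ∑-cong c (λ z → ∑-*ʳ b (v z) _) ⟩
  ∑ c (λ z → ∑ b (λ y → A x y * B y z * v z))
    ≡⟨ ∑-swap c b _ ⟩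
  ∑ b (λ y → ∑ c (λ z → A x y * B y z * v z))
    ≡⟨ ∑-cong b (λ y → ∑-cong c (λ z → *-assoc (A x y) (B y z) (v z))) ⟩
  ∑ b (λ y → ∑ c (λ z → A x y * (B y z * v z)))
    ≡⟨ ∑-cong b (λ y → ∑-*ˡ c (A x y) _) ⟨
  ∑ b (λ y → A x y * ∑ c (λ z → B y z * v z))
    ∎

▸-by-colour : ∀ {a b l} (A : Matrix a b) (g : Fin b → Fin l) (h : Fin l → ℕ) →
              A ▸ (h ∘ g) ≗ λ x → ∑ l (λ d → (A ▸ indicator g d) x * h d)
▸-by-colour {b = b} {l} A g h x = begin
  ∑ b (λ y → A x y * h (g y))
    ≡⟨ ▸-cong A (λ y → ∑-indicator l (g y) h) x ⟨
  ∑ b (λ y → A x y * ∑ l (λ d → indicator g d y * h d))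
    ≡⟨ ∑-cong b (λ y → ∑-*ˡ l (A x y) _) ⟩
  ∑ b (λ y → ∑ l (λ d → A x y * (indicator g d y * h d)))
    ≡⟨ ∑-swap b l _ ⟩
  ∑ l (λ d → ∑ b (λ y → A x y * (indicator g d y * h d)))
    ≡⟨ ∑-cong l (λ d → ∑-cong b (λ y → *-assoc (A x y) (indicator g d y) (h d))) ⟨
  ∑ l (λ d → ∑ b (λ y → A x y * indicator g d y * h d))
    ≡⟨ ∑-cong l (λ d → ∑-*ʳ b (h d) _) ⟨
  ∑ l (λ d → (A ▸ indicator g d) x * h d)
    ∎

-- A record rather than a function, so that its indices can be inferred.
record Equitable {a b k l} (A : Matrix a b) (f : Fin a → Fin k) (g : Fin b → Fin l)
                 (S : Matrix k l) : Set where
  constructor equitable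
  field
    ▸-indicator : ∀ x j → (A ▸ indicator g j) x ≡ S (f x) j

open Equitable

equitable-▸ : ∀ {a b k l} {A : Matrix a b} {f : Fin a → Fin k} {g : Fin b → Fin l} {S : Matrix k l} →
              Equitable A f g S → ∀ h → A ▸ (h ∘ g) ≗ (S ▸ h) ∘ f
equitable-▸ {l = l} {A} {g = g} A-equitable h x =
  trans (▸-by-colour A g h x) (∑-cong l (λ d → cong (_* h d) (▸-indicator A-equitable x d)))

equitable-· : ∀ {a b c k l p} {A : Matrix a b} {B : Matrix b c}
              {f : Fin a → Fin k} {g : Fin b → Fin l} {h : Fin c → Fin p}
              {S : Matrix k l} {T : Matrix l p} →
              Equitable A f g S → Equitable B g h T → Equitable (A · B) f h (S · T)
equitable-· {A = A} {B} {f} {g} {h} {S} {T} A-equitable B-equitable = equitable λ x j → begin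
  ((A · B) ▸ indicator h j) x      ≡⟨ ·-▸-assoc A B (indicator h j) x ⟩
  (A ▸ (B ▸ indicator h j)) x      ≡⟨ ▸-cong A (λ y → ▸-indicator B-equitable y j) x ⟩
  (A ▸ ((λ d → T d j) ∘ g)) x      ≡⟨ equitable-▸ A-equitable (λ d → T d j) x ⟩
  (S · T) (f x) j                  ∎

biadjacency : ∀ {n m} → (Fin n → Fin m → Bool) → Matrix n m
biadjacency Y v u = ⟦ Y v u ⟧

module _ {n m k} (Y : Fin n → Fin m → Bool) (f : Fin n ⊎ Fin m → Fin k) (S : Matrix k k)
         (perfect : ∀ x j → ∑⊎ n m (λ y → bipAdj Y x y * indicator f j y) ≡ S (f x) j) where

  perfect⇒biadjacency-equitable : Equitable (biadjacency Y) (f ∘ inj₁) (f ∘ inj₂) S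
  perfect⇒biadjacency-equitable = equitable λ v j →
    trans (sym (∑⊎-zeroˡ n m (λ y → bipAdj Y (inj₁ v) y * indicator f j y) (λ _ → refl)))
          (perfect (inj₁ v) j)

  perfect⇒transpose-equitable : Equitable (flip (biadjacency Y)) (f ∘ inj₂) (f ∘ inj₁) S
  perfect⇒transpose-equitable = equitable λ u j →
    trans (sym (∑⊎-zeroʳ n m (λ y → bipAdj Y (inj₂ u) y * indicator f j y) (λ _ → refl)))
          (perfect (inj₂ u) j)

proposition3 : (n m k : ℕ) (Y : Fin n → Fin m → Bool) (f : Fin n ⊎ Fin m → Fin k) →
    IsPerfectColoring (∑⊎ n m) (bipAdj Y) k f →
    IsPerfectColoring (∑ n) (M₁₂ Y) k (λ v → f (inj₁ v))
-- M₁₂ Y unfolds to biadjacency Y · flip (biadjacency Y).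
proposition3 n m k Y f (S , perfect) =
  S · S , ▸-indicator (equitable-· (perfect⇒biadjacency-equitable Y f S perfect)
                                   (perfect⇒transpose-equitable Y f S perfect))
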